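{- Let $A$ be a proposition and $t$ a proof-term that is not an introduction, such that every $t'$ with $t\longrightarrow t'$ (one step) belongs to $[\![A]\!]$. Then $t\in[\![A]\!]$.
   Context: The $\odot$-calculus. Propositions: $A ::= \top \mid \bot \mid A \Rightarrow A \mid A \wedge A \mid A \vee A \mid A \odot A$. Proof-terms: $t ::= x \mid t \parallel u \mid * \mid \delta_\bot(t) \mid \lambda x\, t \mid t\,u \mid \langle t,u\rangle \mid \delta_\wedge(t,[x,y]u) \mid \mathrm{inl}(t) \mid \mathrm{inr}(t) \mid \delta_\vee(t,[x]u,[y]v) \mid t+u \mid \delta_\odot(t,[x]u,[y]v) \mid \delta_\odot^\parallel(t,[x]u,[y]v)$, where $\lambda x$ binds $x$, $[x,y]$ binds $x,y$, and $[x]$, $[y]$ bind $x$, $y$; $(u/x)t$ is capture-avoiding substitution. The introductions are the terms of the forms $*$, $\lambda x\,t$, $\langle t,u\rangle$, $\mathrm{inl}(t)$, $\mathrm{inr}(t)$, and $t+u$ (in particular variables and terms $t\parallel u$ are not introductions). Ultra-reduction $\longrightarrow$ is the smallest contextual relation (closed under all term constructors) containing $\sigma l\to\sigma r$ for every substitution $\sigma$ and every rule $l\to r$ among: $(\lambda x\,t)\,u\to(u/x)t$; $\delta_\wedge(\langle t,u\rangle,[x,y]v)\to(t/x,u/y)v$; $\delta_\vee(\mathrm{inl}(t),[x]v,[y]w)\to(t/x)v$; $\delta_\vee(\mathrm{inr}(u),[x]v,[y]w)\to(u/y)w$; $\delta_\odot(t+u,[x]v,[y]w)\to(t/x)v$;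 $\delta_\odot(t+u,[x]v,[y]w)\to(u/y)w$; $\delta_\odot^\parallel(t+u,[x]v,[y]w)\to(t/x)v\parallel(u/y)w$; $(\lambda x\,t)\parallel(\lambda x\,u)\to\lambda x\,(t\parallel u)$; $\langle t,u\rangle\parallel\langle v,w\rangle\to\langle t\parallel v,u\parallel w\rangle$; $\delta_\vee(t\parallel u,[x]v,[y]w)\to\delta_\vee(t,[x]v,[y]w)\parallel\delta_\vee(u,[x]v,[y]w)$; $(t+u)\parallel(v+w)\to(t\parallel v)+(u\parallel w)$; $t\parallel t\to t$; $t\parallel u\to t$; $t\parallel u\to u$. $\longrightarrow^*$ is its reflexive-transitive closure; $t$ strongly terminates if there is no infinite ultra-reduction sequence from $t$. Sets $[\![A]\!]$ are defined by induction on $A$: $t\in[\![\top]\!]$ and $t\in[\![\bot]\!]$ iff $t$ strongly terminates; $t\in[\![A\Rightarrow B]\!]$ iff $t$ strongly terminates and whenever $t\longrightarrow^*\lambda x\,u$, then $(v/x)u\in[\![B]\!]$ for every $v\in[\![A]\!]$; $t\in[\![A\wedge B]\!]$ iff $t$ strongly terminates and whenever $t\longrightarrow^*\langle u,v\rangle$, then $u\in[\![A]\!]$ and $v\in[\![B]\!]$; $t\in[\![A\vee B]\!]$ iff $t$ strongly terminates, whenever $t\longrightarrow^*\mathrm{inl}(u)$ then $u\in[\![A]\!]$, and whenever $t\longrightarrow^*\mathrm{inr}(v)$ then $v\in[\![B]\!]$; $t\in[\![A\odot B]\!]$ iff $t$ strongly terminates and whenever $t\longrightarrow^* u+v$, then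 $u\in[\![A]\!]$ and $v\in[\![B]\!]$. -}

module Defs where

open import Data.Nat using (ℕ; zero; suc)
open import Data.Fin using (Fin; zero; suc)
open import Data.Product using (_×_)
open import Induction.WellFounded using (Acc)
open import Relation.Binary.Construct.Closure.ReflexiveTransitive using (Star)

data Prop : Set where
  ⊤′ ⊥′ : Prop
  _⇒_ _∧_ _∨_ _⊙_ : Prop → Prop → Prop

-- Proof-terms, well-scoped de Bruijn syntax (terms up to α-equivalence).
-- Tm n = terms with at most n free variables.
-- In binders [x,y]u the variable y is index 0 and x is index 1.

data Tm (n : ℕ) : Set where
  var   : Fin n → Tm n
  _∥_   : Tm n → Tm n → Tm n
  star  : Tm n
  δ⊥    : Tm n → Tm n
  lam   : Tm (suc n) → Tm n
  app   : Tm n → Tm n → Tm n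
  pair  : Tm n → Tm n → Tm n
  δ∧    : Tm n → Tm (suc (suc n)) → Tm n
  inl   : Tm n → Tm n
  inr   : Tm n → Tm n
  δ∨    : Tm n → Tm (suc n) → Tm (suc n) → Tm n
  _⊕_   : Tm n → Tm n → Tm n
  δ⊙    : Tm n → Tm (suc n) → Tm (suc n) → Tm n
  δ⊙∥   : Tm n → Tm (suc n) → Tm (suc n) → Tm n

Ren : ℕ → ℕ → Set
Ren m n = Fin m → Fin n

ext : ∀ {m n} → Ren m n → Ren (suc m) (suc n)
ext ρ zero    = zero
ext ρ (suc i) = suc (ρ i)

rename : ∀ {m n} → Ren m n → Tm m → Tm n
rename ρ (var i)       = var (ρ i)
rename ρ (t ∥ u)       = rename ρ t ∥ rename ρ u
rename ρ star          = star
rename ρ (δ⊥ t)        = δ⊥ (rename ρ t)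
rename ρ (lam t)       = lam (rename (ext ρ) t)
rename ρ (app t u)     = app (rename ρ t) (rename ρ u)
rename ρ (pair t u)    = pair (rename ρ t) (rename ρ u)
rename ρ (δ∧ t u)      = δ∧ (rename ρ t) (rename (ext (ext ρ)) u)
rename ρ (inl t)       = inl (rename ρ t)
rename ρ (inr t)       = inr (rename ρ t)
rename ρ (δ∨ t u v)    = δ∨ (rename ρ t) (rename (ext ρ) u) (rename (ext ρ) v)
rename ρ (t ⊕ u)       = rename ρ t ⊕ rename ρ u
rename ρ (δ⊙ t u v)    = δ⊙ (rename ρ t) (rename (ext ρ) u) (rename (ext ρ) v)
rename ρ (δ⊙∥ t u v)   = δ⊙∥ (rename ρ t) (rename (ext ρ) u) (rename (ext ρ) v)

Sub : ℕ → ℕ → Set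
Sub m n = Fin m → Tm n

exts : ∀ {m n} → Sub m n → Sub (suc m) (suc n)
exts σ zero    = var zero
exts σ (suc i) = rename suc (σ i)

subst : ∀ {m n} → Sub m n → Tm m → Tm n
subst σ (var i)       = σ i
subst σ (t ∥ u)       = subst σ t ∥ subst σ u
subst σ star          = star
subst σ (δ⊥ t)        = δ⊥ (subst σ t)
subst σ (lam t)       = lam (subst (exts σ) t)
subst σ (app t u)     = app (subst σ t) (subst σ u)
subst σ (pair t u)    = pair (subst σ t) (subst σ u)
subst σ (δ∧ t u)      = δ∧ (subst σ t) (subst (exts (exts σ)) u)
subst σ (inl t)       = inl (subst σ t)
subst σ (inr t)       = inr (subst σ t)
subst σ (δ∨ t u v)    = δ∨ (subst σ t) (subst (exts σ) u) (subst (exts σ) v)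
subst σ (t ⊕ u)       = subst σ t ⊕ subst σ u
subst σ (δ⊙ t u v)    = δ⊙ (subst σ t) (subst (exts σ) u) (subst (exts σ) v)
subst σ (δ⊙∥ t u v)   = δ⊙∥ (subst σ t) (subst (exts σ) u) (subst (exts σ) v)

_[_] : ∀ {n} → Tm (suc n) → Tm n → Tm n
_[_] {n} t u = subst σ t
  where
  σ : Sub (suc n) n
  σ zero    = u
  σ (suc i) = var i

_[_,_] : ∀ {n} → Tm (suc (suc n)) → Tm n → Tm n → Tm n
_[_,_] {n} v t u = subst σ v
  where
  σ : Sub (suc (suc n)) n
  σ zero          = u
  σ (suc zero)    = t
  σ (suc (suc i)) = var i

infix 4 _⟶_
data _⟶_ {n : ℕ} : Tm n → Tm n → Set where
  β⇒    : ∀ t u → app (lam t) u ⟶ t [ u ]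
  β∧    : ∀ t u v → δ∧ (pair t u) v ⟶ v [ t , u ]
  β∨l   : ∀ t v w → δ∨ (inl t) v w ⟶ v [ t ]
  β∨r   : ∀ u v w → δ∨ (inr u) v w ⟶ w [ u ]
  β⊙l   : ∀ t u v w → δ⊙ (t ⊕ u) v w ⟶ v [ t ]
  β⊙r   : ∀ t u v w → δ⊙ (t ⊕ u) v w ⟶ w [ u ]
  β⊙∥   : ∀ t u v w → δ⊙∥ (t ⊕ u) v w ⟶ (v [ t ]) ∥ (w [ u ])
  ∥lam  : ∀ t u → lam t ∥ lam u ⟶ lam (t ∥ u)
  ∥pair : ∀ t u v w → pair t u ∥ pair v w ⟶ pair (t ∥ v) (u ∥ w)
  ∥δ∨   : ∀ t u v w → δ∨ (t ∥ u) v w ⟶ δ∨ t v w ∥ δ∨ u v w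
  ∥⊕    : ∀ t u v w → (t ⊕ u) ∥ (v ⊕ w) ⟶ (t ∥ v) ⊕ (u ∥ w)
  ∥idem : ∀ t → t ∥ t ⟶ t
  ∥l    : ∀ t u → t ∥ u ⟶ t
  ∥r    : ∀ t u → t ∥ u ⟶ u
  ∥₁    : ∀ {t t′ u} → t ⟶ t′ → t ∥ u ⟶ t′ ∥ u
  ∥₂    : ∀ {t u u′} → u ⟶ u′ → t ∥ u ⟶ t ∥ u′
  δ⊥₁   : ∀ {t t′} → t ⟶ t′ → δ⊥ t ⟶ δ⊥ t′
  lam₁  : ∀ {t t′ : Tm (suc n)} → t ⟶ t′ → lam t ⟶ lam t′
  app₁  : ∀ {t t′ u} → t ⟶ t′ → app t u ⟶ app t′ u
  app₂  : ∀ {t u u′} → u ⟶ u′ → app t u ⟶ app t u′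
  pair₁ : ∀ {t t′ u} → t ⟶ t′ → pair t u ⟶ pair t′ u
  pair₂ : ∀ {t u u′} → u ⟶ u′ → pair t u ⟶ pair t u′
  δ∧₁   : ∀ {t t′ u} → t ⟶ t′ → δ∧ t u ⟶ δ∧ t′ u
  δ∧₂   : ∀ {t} {u u′ : Tm (suc (suc n))} → u ⟶ u′ → δ∧ t u ⟶ δ∧ t u′
  inl₁  : ∀ {t t′} → t ⟶ t′ → inl t ⟶ inl t′
  inr₁  : ∀ {t t′} → t ⟶ t′ → inr t ⟶ inr t′
  δ∨₁   : ∀ {t t′ u v} → t ⟶ t′ → δ∨ t u v ⟶ δ∨ t′ u v
  δ∨₂   : ∀ {t} {u u′ v : Tm (suc n)} → u ⟶ u′ → δ∨ t u v ⟶ δ∨ t u′ v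
  δ∨₃   : ∀ {t} {u v v′ : Tm (suc n)} → v ⟶ v′ → δ∨ t u v ⟶ δ∨ t u v′
  ⊕₁    : ∀ {t t′ u} → t ⟶ t′ → t ⊕ u ⟶ t′ ⊕ u
  ⊕₂    : ∀ {t u u′} → u ⟶ u′ → t ⊕ u ⟶ t ⊕ u′
  δ⊙₁   : ∀ {t t′ u v} → t ⟶ t′ → δ⊙ t u v ⟶ δ⊙ t′ u v
  δ⊙₂   : ∀ {t} {u u′ v : Tm (suc n)} → u ⟶ u′ → δ⊙ t u v ⟶ δ⊙ t u′ v
  δ⊙₃   : ∀ {t} {u v v′ : Tm (suc n)} → v ⟶ v′ → δ⊙ t u v ⟶ δ⊙ t u v′
  δ⊙∥₁  : ∀ {t t′ u v} → t ⟶ t′ → δ⊙∥ t u v ⟶ δ⊙∥ t′ u v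
  δ⊙∥₂  : ∀ {t} {u u′ v : Tm (suc n)} → u ⟶ u′ → δ⊙∥ t u v ⟶ δ⊙∥ t u′ v
  δ⊙∥₃  : ∀ {t} {u v v′ : Tm (suc n)} → v ⟶ v′ → δ⊙∥ t u v ⟶ δ⊙∥ t u v′

infix 4 _⟶*_
_⟶*_ : ∀ {n} → Tm n → Tm n → Set
_⟶*_ = Star _⟶_

SN : ∀ {n} → Tm n → Set
SN {n} t = Acc (λ u v → v ⟶ u) t

data IsIntro {n : ℕ} : Tm n → Set where
  i-star : IsIntro star
  i-lam  : ∀ t → IsIntro (lam t)
  i-pair : ∀ t u → IsIntro (pair t u)
  i-inl  : ∀ t → IsIntro (inl t)
  i-inr  : ∀ t → IsIntro (inr t)
  i-plus : ∀ t u → IsIntro (t ⊕ u)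

⟦_⟧ : Prop → ∀ {n} → Tm n → Set
⟦ ⊤′ ⟧    t = SN t
⟦ ⊥′ ⟧    t = SN t
⟦ A ⇒ B ⟧ t = SN t × (∀ u → t ⟶* lam u → ∀ v → ⟦ A ⟧ v → ⟦ B ⟧ (u [ v ]))
⟦ A ∧ B ⟧ t = SN t × (∀ u v → t ⟶* pair u v → ⟦ A ⟧ u × ⟦ B ⟧ v)
⟦ A ∨ B ⟧ t = SN t × (∀ u → t ⟶* inl u → ⟦ A ⟧ u)
                   × (∀ v → t ⟶* inr v → ⟦ B ⟧ v)
⟦ A ⊙ B ⟧ t = SN t × (∀ u v → t ⟶* (u ⊕ v) → ⟦ A ⟧ u × ⟦ B ⟧ v)

-- Besides strong termination, membership in ⟦ A ⟧ only constrains the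
-- introductions that t reduces to. A reduction from a non-introduction to an
-- introduction is nonempty, so it passes through a one-step reduct, and that
-- reduct is reducible by hypothesis.
module Submission where

open import Defs
open import Data.Nat using (ℕ)
open import Relation.Nullary using (¬_)
open import Data.Product using (_×_; _,_; proj₁; proj₂; ∃-syntax)
open import Data.Empty using (⊥-elim)
open import Induction.WellFounded using (acc)
open import Relation.Binary.Construct.Closure.ReflexiveTransitive using (ε; _◅_)

⟦⟧⇒SN : (A : Prop) {n : ℕ} {t : Tm n} → ⟦ A ⟧ t → SN t
⟦⟧⇒SN ⊤′      t∈A = t∈A
⟦⟧⇒SN ⊥′      t∈A = t∈A
⟦⟧⇒SN (A ⇒ B) t∈A = proj₁ t∈A
⟦⟧⇒SN (A ∧ B) t∈A = proj₁ t∈A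
⟦⟧⇒SN (A ∨ B) t∈A = proj₁ t∈A
⟦⟧⇒SN (A ⊙ B) t∈A = proj₁ t∈A

SN-fromReducts : (A : Prop) {n : ℕ} {t : Tm n} → (∀ t′ → t ⟶ t′ → ⟦ A ⟧ t′) → SN t
SN-fromReducts A reducts = acc λ {t′} t⟶t′ → ⟦⟧⇒SN A (reducts t′ t⟶t′)

nonIntro-⟶*-intro : {n : ℕ} {t w : Tm n} → ¬ IsIntro t → IsIntro w → t ⟶* w →
                    ∃[ t′ ] (t ⟶ t′ × t′ ⟶* w)
nonIntro-⟶*-intro t∉I w∈I ε        = ⊥-elim (t∉I w∈I)
nonIntro-⟶*-intro t∉I w∈I (r ◅ rs) = _ , r , rs

mainTheorem6 : (A : Prop) {n : ℕ} (t : Tm n) → ¬ IsIntro t →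
                   (∀ t′ → t ⟶ t′ → ⟦ A ⟧ t′) → ⟦ A ⟧ t
mainTheorem6 ⊤′      t t∉I reducts = SN-fromReducts ⊤′ reducts
mainTheorem6 ⊥′      t t∉I reducts = SN-fromReducts ⊥′ reducts
mainTheorem6 (A ⇒ B) t t∉I reducts = SN-fromReducts (A ⇒ B) reducts , λ u t↠ →
  let t′ , r , rs = nonIntro-⟶*-intro t∉I (i-lam u) t↠ in proj₂ (reducts t′ r) u rs
mainTheorem6 (A ∧ B) t t∉I reducts = SN-fromReducts (A ∧ B) reducts , λ u v t↠ →
  let t′ , r , rs = nonIntro-⟶*-intro t∉I (i-pair u v) t↠ in proj₂ (reducts t′ r) u v rs
mainTheorem6 (A ∨ B) t t∉I reducts = SN-fromReducts (A ∨ B) reducts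
  , (λ u t↠ → let t′ , r , rs = nonIntro-⟶*-intro t∉I (i-inl u) t↠
               in proj₁ (proj₂ (reducts t′ r)) u rs)
  , (λ v t↠ → let t′ , r , rs = nonIntro-⟶*-intro t∉I (i-inr v) t↠
               in proj₂ (proj₂ (reducts t′ r)) v rs)
mainTheorem6 (A ⊙ B) t t∉I reducts = SN-fromReducts (A ⊙ B) reducts , λ u v t↠ →
  let t′ , r , rs = nonIntro-⟶*-intro t∉I (i-plus u v) t↠ in proj₂ (reducts t′ r) u v rs
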